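{- Let $G$ be a connected finite simple graph that has a perfect matching, and let $M$ be a perfect matching of $G$. If the KE-part of $G$ is empty (i.e. $V_{SD}(G) = V(G)$), then for every $v \in V(G)$ we have $R(M,v) = V(G)$.
   Context: A walk is $M$-alternating if, for each pair of consecutive edges, exactly one belongs to $M$; it is $M$-$mm$-alternating if moreover its first and last edges belong to $M$. $R(M,v)$ is the set of vertices $u$ for which there exists an $M$-$mm$-alternating walk between $u$ and $v$. An $M$-blossom is an odd cycle of length $2k+1$ containing exactly $k$ edges of $M$; its base is the unique vertex of the cycle not matched by $M$ to another vertex of the cycle. An $M$-Jposy is a configuration consisting of two, not necessarily distinct, $M$-blossoms joined by an odd-length $M$-alternating walk (starting and ending with edges of $M$) whose endpoints are the bases of the two blossoms. $V_{SD}(G)$ is the set of vertices lying on an $M'$-Jposy for some perfect matching $M'$ of $G$; the SD-part is $G[V_{SD}(G)]$ and the KE-part is $G$ minus the SD-part (i.e. $G[V(G)\setminus V_{SD}(G)]$). -}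

module Defs where

open import Data.Nat using (ℕ; zero; suc; _+_)
open import Data.Nat.DivMod using (_mod_)
open import Data.Fin using (Fin; toℕ)
open import Data.Fin.Subset using (Subset; _∈_; ∣_∣)
open import Data.List using (List; []; _∷_; _++_; length)
open import Data.List.Membership.Propositional renaming (_∈_ to _∈ₗ_)
open import Data.Product using (Σ; ∃; _×_; _,_)
open import Data.Sum using (_⊎_)
open import Data.Unit using (⊤)
open import Data.Empty using (⊥)
open import Relation.Nullary using (¬_)
open import Relation.Binary using (Decidable)
open import Relation.Binary.PropositionalEquality using (_≡_)
open import Function.Bundles using (_⇔_)
open import Level using (Level; 0ℓ) renaming (suc to lsuc)

record Graph (n : ℕ) : Set₁ where
  field
    Adj    : Fin n → Fin n → Set
    sym    : ∀ {u v} → Adj u v → Adj v u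
    irrefl : ∀ {v} → ¬ Adj v v
    dec    : Decidable Adj

open Graph public

EdgeSet : ℕ → Set₁
EdgeSet n = Fin n → Fin n → Set

record IsMatching {n : ℕ} (G : Graph n) (M : EdgeSet n) : Set where
  field
    sub  : ∀ {u v} → M u v → Adj G u v
    msym : ∀ {u v} → M u v → M v u
    uniq : ∀ {u v w} → M u v → M u w → v ≡ w

record IsPerfectMatching {n : ℕ} (G : Graph n) (M : EdgeSet n) : Set where
  field
    matching : IsMatching G M
    cover    : ∀ u → ∃ λ v → M u v

data Reachable {n : ℕ} (G : Graph n) : Fin n → Fin n → Set where
  here : ∀ {u} → Reachable G u u
  step : ∀ {u w v} → Adj G u w → Reachable G w v → Reachable G u v

Connected : ∀ {n} → Graph n → Set
Connected {n} G = ∀ (u v : Fin n) → Reachable G u v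

-- Walks are given by their vertex lists; a walk with at least one edge from
-- u to v is the list  u ∷ (mid ++ v ∷ [])  (it has length mid + 1 edges).
walkList : ∀ {n} → Fin n → List (Fin n) → Fin n → List (Fin n)
walkList u mid v = u ∷ (mid ++ v ∷ [])

IsWalk : ∀ {n} → Graph n → List (Fin n) → Set
IsWalk G []            = ⊥
IsWalk G (x ∷ [])      = ⊤
IsWalk G (x ∷ y ∷ r)   = Adj G x y × IsWalk G (y ∷ r)

ExactlyOne : Set → Set → Set
ExactlyOne P Q = (P × ¬ Q) ⊎ (¬ P × Q)

AltEdges : ∀ {n} → EdgeSet n → List (Fin n) → Set
AltEdges M (x ∷ y ∷ z ∷ r) = ExactlyOne (M x y) (M y z) × AltEdges M (y ∷ z ∷ r)
AltEdges M _               = ⊤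

FirstInM : ∀ {n} → EdgeSet n → List (Fin n) → Set
FirstInM M (x ∷ y ∷ r) = M x y
FirstInM M _           = ⊥

LastInM : ∀ {n} → EdgeSet n → List (Fin n) → Set
LastInM M (x ∷ y ∷ [])    = M x y
LastInM M (x ∷ y ∷ z ∷ r) = LastInM M (y ∷ z ∷ r)
LastInM M _               = ⊥

IsAltWalk : ∀ {n} → Graph n → EdgeSet n → List (Fin n) → Set
IsAltWalk G M w = IsWalk G w × AltEdges M w

IsMMAltWalk : ∀ {n} → Graph n → EdgeSet n → List (Fin n) → Set
IsMMAltWalk G M w = IsAltWalk G M w × FirstInM M w × LastInM M w

-- u ∈ R(M,v): there is an M-mm-alternating walk between u and v
InR : ∀ {n} → Graph n → EdgeSet n → Fin n → Fin n → Set
InR G M v u = ∃ λ mid → IsMMAltWalk G M (walkList u mid v)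

next : ∀ {m} → Fin (suc m) → Fin (suc m)
next {m} i = suc (toℕ i) mod (suc m)

-- An M-blossom: a cycle c_0 … c_{2k} (distinct vertices, c_i ~ c_{i+1 mod 2k+1})
-- of length 2k+1 whose edge set contains exactly k edges of M (the edge with
-- index i being {c_i , c_{next i}}; S is the set of indices of M-edges).
record Blossom {n : ℕ} (G : Graph n) (M : EdgeSet n) : Set where
  field
    k      : ℕ
    c      : Fin (suc (k + k)) → Fin n
    inj    : ∀ i j → c i ≡ c j → i ≡ j
    adj    : ∀ i → Adj G (c i) (c (next i))
    Medges : Subset (suc (k + k))
    count  : ∣ Medges ∣ ≡ k
    isM    : ∀ i → (i ∈ Medges) ⇔ M (c i) (c (next i))

open Blossom public

OnBlossom : ∀ {n} {G : Graph n} {M : EdgeSet n} → Fin n → Blossom G M → Set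
OnBlossom x B = ∃ λ i → c B i ≡ x

IsBase : ∀ {n} {G : Graph n} {M : EdgeSet n} → Blossom G M → Fin n → Set
IsBase {M = M} B b = OnBlossom b B × (∀ j → ¬ M b (c B j))

data Even : ℕ → Set where
  ev0  : Even zero
  ev2+ : ∀ {m} → Even m → Even (suc (suc m))

-- An M-Jposy: blossoms B₁, B₂ (not necessarily distinct) with bases b₁, b₂
-- joined by an odd-length M-alternating walk b₁ ∷ mid ++ [b₂] whose first and
-- last edges are in M.  (Number of edges = length mid + 1, odd iff mid even.)
record Jposy {n : ℕ} (G : Graph n) (M : EdgeSet n) : Set where
  field
    B₁ B₂   : Blossom G M
    b₁ b₂   : Fin n
    base₁   : IsBase B₁ b₁
    base₂   : IsBase B₂ b₂
    mid     : List (Fin n)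
    odd     : Even (length mid)
    walk    : IsMMAltWalk G M (walkList b₁ mid b₂)

open Jposy public

OnJposy : ∀ {n} {G : Graph n} {M : EdgeSet n} → Fin n → Jposy G M → Set
OnJposy x J = OnBlossom x (B₁ J) ⊎ OnBlossom x (B₂ J) ⊎ x ∈ₗ walkList (b₁ J) (mid J) (b₂ J)

InVSD : ∀ {n} → Graph n → Fin n → Set₁
InVSD {n} G x = Σ (EdgeSet n) λ M' → IsPerfectMatching G M' × Σ (Jposy G M') λ J → OnJposy x J

KEPartEmpty : ∀ {n} → Graph n → Set₁
KEPartEmpty {n} G = ∀ (x : Fin n) → InVSD G x

-- Let S be the set of vertices reachable from u along the digraph p ⇝ q (an M-edge from p to its
-- mate, then a non-M edge to q).  If mate v ∈ S, such a path followed by the edge mate v – v is an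
-- M-mm-alternating walk from u to v.  Otherwise, as G is connected, X = {x ∉ S ∣ mate x ∈ S} is
-- nonempty.  Closure of S puts every neighbour of X into Y = {y ∈ S ∣ mate y ∉ S}, and mate maps
-- Y into X; so for any perfect matching M′ the injection mate′ ∘ mate of Y into itself is onto,
-- i.e. M′ matches Y into X.  An M′-alternating walk through X is therefore trapped, going from X
-- to Y along non-M′ edges and from Y to X along M′ edges, and it ends in X through an M′-edge or
-- in Y through a non-M′ edge.  Counting its M′-edges, a blossom alternates when read from its
-- base, whose two cycle edges are not in M′; hence a blossom meeting X has its base in Y, bases
-- never lie in X, and no M′-Jposy meets X, contradicting V_SD(G) = V(G).

module Submission where

open import Data.Bool using (Bool; true; false; not)
open import Data.Bool.Properties using (T-≡)
open import Data.Empty using (⊥; ⊥-elim)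
open import Data.Fin using (Fin; toℕ; _≟_)
import Data.Fin.Properties as Fin
open import Data.Fin.Subset using (Subset; ∣_∣; inside; outside; _∈_; _∉_; _⊆_; ⁅_⁆)
open import Data.Fin.Subset.Properties using (_∈?_; x∈⁅x⁆; x∈⁅y⁆⇒x≡y; p⊂q⇒∣p∣<∣q∣; ∣p∣≤n)
open import Data.List using (List; []; _∷_)
open import Data.List.Membership.Propositional using () renaming (_∈_ to _∈ₗ_)
open import Data.List.Relation.Unary.Any using (here; there)
open import Data.Nat using (ℕ; zero; suc; _+_; _*_; _∸_; _≤_; _<_; z≤n; s≤s; z<s)
open import Data.Nat.Divisibility using (_∣_; ∣⇒≤; ∣m+n∣m⇒∣n; n∣m*n)
open import Data.Nat.DivMod
  using (_%_; _/_; _mod_; m%n<n; m%n≤n; m<n⇒m%n≡m; m%n%n≡m%n; [m+n]%n≡m%n; %-distribˡ-+; m≡m%n+[m/n]*n)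
open import Data.Nat.Properties
  using (+-suc; +-assoc; +-comm; +-identityʳ; +-cancelˡ-≡; *-comm; ≤-pred; ≤-trans; m≤n⇒m≤1+n; <-irrefl;
         n<1+n; m≤n⇒∃[o]m+o≡n; m∸n+n≡m; <⇒≤; ≤⇒≯; n<1⇒n≡0)
open import Data.Product using (Σ; ∃; ∃₂; _×_; _,_; proj₁; proj₂)
open import Data.Sum using (_⊎_; inj₁; inj₂)
open import Data.Unit using (tt)
open import Data.Vec using (Vec; []; _∷_; lookup; tabulate)
open import Data.Vec.Properties using ([]=⇒lookup; lookup⇒[]=; lookup∘tabulate)
open import Function using (_∘_; id; case_of_)
open import Function.Bundles using (Equivalence)
open import Relation.Binary.Construct.Closure.ReflexiveTransitive using (Star; ε; _◅_; _◅◅_)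
open import Relation.Binary.PropositionalEquality
  using (_≡_; _≢_; refl; sym; trans; cong; cong₂; subst; subst₂; module ≡-Reasoning)
open import Relation.Nullary using (¬_; Dec; yes; no; contradiction; ¬?)
open import Relation.Nullary.Decidable
  using (_×-dec_; _⊎-dec_; isYes; toWitness; fromWitness; decidable-stable)

open import Defs hiding (sym)

iterate : ∀ {A : Set} → (A → A) → ℕ → A → A
iterate f zero    x = x
iterate f (suc i) x = f (iterate f i x)

module _ {A : Set} (f : A → A) where

  iterate-+ : ∀ i j x → iterate f (i + j) x ≡ iterate f i (iterate f j x)
  iterate-+ zero    j x = refl
  iterate-+ (suc i) j x = cong f (iterate-+ i j x)

  iterate-injective : (∀ {x y} → f x ≡ f y → x ≡ y) →
    ∀ i {x y} → iterate f i x ≡ iterate f i y → x ≡ y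
  iterate-injective f-inj zero    eq = eq
  iterate-injective f-inj (suc i) eq = iterate-injective f-inj i (f-inj eq)

  iterate-preserves : {P : A → Set} → (∀ {x} → P x → P (f x)) → ∀ i {x} → P x → P (iterate f i x)
  iterate-preserves f-pres zero    px = px
  iterate-preserves {P} f-pres (suc i) px = f-pres (iterate-preserves {P} f-pres i px)

-- Some two of y, f y, …, fⁿ y coincide, and cancelling the smaller power exhibits y as f (fᵒ y).
injective⇒preimage : ∀ {n} (f : Fin n → Fin n) → (∀ {x y} → f x ≡ f y → x ≡ y) →
  (P : Fin n → Set) → (∀ {x} → P x → P (f x)) → ∀ {y} → P y → ∃ λ w → P w × f w ≡ y
injective⇒preimage {n} f f-inj P f-pres {y} py
  with i , j , i<j , fⁱy≡fʲy ← Fin.pigeonhole (n<1+n n) (λ i → iterate f (toℕ i) y)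
  with o , i+1+o≡j ← m≤n⇒∃[o]m+o≡n i<j
  = iterate f o y , iterate-preserves f {P} f-pres o py ,
    sym (iterate-injective f f-inj (toℕ i) fⁱy≡fⁱ⁺¹⁺ᵒy)
  where
    fⁱy≡fⁱ⁺¹⁺ᵒy : iterate f (toℕ i) y ≡ iterate f (toℕ i) (iterate f (suc o) y)
    fⁱy≡fⁱ⁺¹⁺ᵒy = begin
      iterate f (toℕ i) y
        ≡⟨ fⁱy≡fʲy ⟩
      iterate f (toℕ j) y
        ≡⟨ cong (λ m → iterate f m y) (sym (trans (+-suc (toℕ i) o) i+1+o≡j)) ⟩
      iterate f (toℕ i + suc o) y
        ≡⟨ iterate-+ f (toℕ i) (suc o) y ⟩
      iterate f (toℕ i) (iterate f (suc o) y) ∎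
      where open ≡-Reasoning

increasing-chain-stalls : ∀ {n} (P : ℕ → Subset n) → (∀ j → P j ⊆ P (suc j)) →
  ∃ λ j → P (suc j) ⊆ P j
increasing-chain-stalls {n} P P-increasing with stalls-or-grows (suc n)
  where
    stalls-or-grows : ∀ j → (∃ λ i → P (suc i) ⊆ P i) ⊎ j ≤ ∣ P j ∣
    stalls-or-grows zero    = inj₂ z≤n
    stalls-or-grows (suc j) with stalls-or-grows j
    ... | inj₁ stall = inj₁ stall
    ... | inj₂ j≤∣Pj∣ with Fin.any? (λ x → x ∈? P (suc j) ×-dec ¬? (x ∈? P j))
    ...   | yes new = inj₂ (≤-trans (s≤s j≤∣Pj∣) (p⊂q⇒∣p∣<∣q∣ (P-increasing j , new)))
    ...   | no ¬new = inj₁ (j , λ {x} x∈ → decidable-stable (x ∈? P j) λ x∉ → ¬new (x , x∈ , x∉))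
... | inj₁ stall = stall
... | inj₂ n<∣P∣ = contradiction (≤-trans n<∣P∣ (∣p∣≤n (P (suc n)))) (<-irrefl refl)

module Reachability {n : ℕ} {_⇝_ : Fin n → Fin n → Set} (_⇝?_ : ∀ p q → Dec (p ⇝ q)) (u : Fin n) where

  Grow : Subset n → Fin n → Set
  Grow P w = w ∈ P ⊎ ∃ λ p → p ∈ P × p ⇝ w

  Grow? : ∀ P w → Dec (Grow P w)
  Grow? P w = w ∈? P ⊎-dec Fin.any? λ p → p ∈? P ×-dec p ⇝? w

  grow : Subset n → Subset n
  grow P = tabulate (isYes ∘ Grow? P)

  ∈-grow⁺ : ∀ {P w} → Grow P w → w ∈ grow P
  ∈-grow⁺ {P} {w} g = lookup⇒[]= w (grow P) (trans (lookup∘tabulate _ w) (Equivalence.to T-≡ (fromWitness g)))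

  ∈-grow⁻ : ∀ {P w} → w ∈ grow P → Grow P w
  ∈-grow⁻ {P} {w} w∈ = toWitness (Equivalence.from T-≡ (trans (sym (lookup∘tabulate _ w)) ([]=⇒lookup w∈)))

  level : ℕ → Subset n
  level j = iterate grow j ⁅ u ⁆

  level⇒⇝* : ∀ j {w} → w ∈ level j → Star _⇝_ u w
  level⇒⇝* zero    w∈ with refl ← x∈⁅y⁆⇒x≡y u w∈ = ε
  level⇒⇝* (suc j) w∈ with ∈-grow⁻ w∈
  ... | inj₁ w∈′               = level⇒⇝* j w∈′
  ... | inj₂ (p , p∈ , p⇝w)   = level⇒⇝* j p∈ ◅◅ p⇝w ◅ ε

  private
    stall : ∃ λ j → level (suc j) ⊆ level j
    stall = increasing-chain-stalls level λ j → ∈-grow⁺ ∘ inj₁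

  reachable : Subset n
  reachable = level (proj₁ stall)

  u∈reachable : u ∈ reachable
  u∈reachable = iterate-preserves grow {u ∈_} (∈-grow⁺ ∘ inj₁) (proj₁ stall) (x∈⁅x⁆ u)

  reachable-closed : ∀ {p q} → p ∈ reachable → p ⇝ q → q ∈ reachable
  reachable-closed p∈ p⇝q = proj₂ stall (∈-grow⁺ (inj₂ (_ , p∈ , p⇝q)))

  reachable⇒⇝* : ∀ {w} → w ∈ reachable → Star _⇝_ u w
  reachable⇒⇝* = level⇒⇝* (proj₁ stall)

bit : Bool → ℕ
bit true  = 1
bit false = 0

countTrue : ℕ → (ℕ → Bool) → ℕ
countTrue zero    f = 0
countTrue (suc L) f = bit (f 0) + countTrue L (f ∘ suc)

countTrue-cong : ∀ L {f g : ℕ → Bool} → (∀ s → s < L → f s ≡ g s) → countTrue L f ≡ countTrue L g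
countTrue-cong zero    f≗g = refl
countTrue-cong (suc L) f≗g =
  cong₂ _+_ (cong bit (f≗g 0 z<s)) (countTrue-cong L λ s s<L → f≗g (suc s) (s≤s s<L))

countTrue-snoc : ∀ L f → countTrue (suc L) f ≡ countTrue L f + bit (f L)
countTrue-snoc zero    f = +-identityʳ (bit (f 0))
countTrue-snoc (suc L) f =
  trans (cong (bit (f 0) +_) (countTrue-snoc L (f ∘ suc))) (sym (+-assoc (bit (f 0)) _ _))

countTrue-rotate₁ : ∀ L f → f L ≡ f 0 → countTrue L (f ∘ suc) ≡ countTrue L f
countTrue-rotate₁ L f fL≡f0 = +-cancelˡ-≡ (bit (f 0)) _ _ (begin
  bit (f 0) + countTrue L (f ∘ suc) ≡⟨ countTrue-snoc L f ⟩
  countTrue L f + bit (f L)         ≡⟨ cong (λ b → countTrue L f + bit b) fL≡f0 ⟩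
  countTrue L f + bit (f 0)         ≡⟨ +-comm (countTrue L f) _ ⟩
  bit (f 0) + countTrue L f         ∎)
  where open ≡-Reasoning

countTrue-rotate : ∀ L f → (∀ s → f (s + L) ≡ f s) →
  ∀ p → countTrue L (λ s → f (p + s)) ≡ countTrue L f
countTrue-rotate L f periodic zero    = refl
countTrue-rotate L f periodic (suc p) = begin
  countTrue L (λ s → f (suc p + s)) ≡⟨ countTrue-cong L (λ s _ → cong f (sym (+-suc p s))) ⟩
  countTrue L (λ s → f (p + suc s)) ≡⟨ countTrue-rotate₁ L (λ s → f (p + s)) fp+L≡fp+0 ⟩
  countTrue L (λ s → f (p + s))     ≡⟨ countTrue-rotate L f periodic p ⟩
  countTrue L f                     ∎
  where
    open ≡-Reasoning
    fp+L≡fp+0 : f (p + L) ≡ f (p + 0)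
    fp+L≡fp+0 = trans (periodic p) (cong f (sym (+-identityʳ p)))

lookupℕ : ∀ {n} → Vec Bool n → ℕ → Bool
lookupℕ []       s       = false
lookupℕ (x ∷ xs) zero    = x
lookupℕ (x ∷ xs) (suc s) = lookupℕ xs s

lookupℕ-toℕ : ∀ {n} (xs : Vec Bool n) i → lookupℕ xs (toℕ i) ≡ lookup xs i
lookupℕ-toℕ (x ∷ xs) Fin.zero    = refl
lookupℕ-toℕ (x ∷ xs) (Fin.suc i) = lookupℕ-toℕ xs i

∣p∣≡countTrue : ∀ {n} (p : Subset n) → ∣ p ∣ ≡ countTrue n (lookupℕ p)
∣p∣≡countTrue []            = refl
∣p∣≡countTrue (inside  ∷ p) = cong suc (∣p∣≡countTrue p)
∣p∣≡countTrue (outside ∷ p) = ∣p∣≡countTrue p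

NoTwoConsecutive : (ℕ → Bool) → Set
NoTwoConsecutive f = ∀ s → f s ≡ true → f (suc s) ≡ true → ⊥

Alternating : ℕ → (ℕ → Bool) → Set
Alternating L f = ∀ s → suc s < L → f (suc s) ≡ not (f s)

countTrue≤half : ∀ k f → NoTwoConsecutive f → countTrue (k * 2) f ≤ k
countTrue≤half zero    f no2 = z≤n
countTrue≤half (suc k) f no2 = pair (f 0) (f 1) (no2 0) (countTrue≤half k (f ∘ suc ∘ suc) (no2 ∘ suc ∘ suc))
  where
    pair : ∀ a b {c} → (a ≡ true → b ≡ true → ⊥) → c ≤ k → bit a + (bit b + c) ≤ suc k
    pair true  true  no2 c≤k = ⊥-elim (no2 refl refl)
    pair true  false no2 c≤k = s≤s c≤k
    pair false true  no2 c≤k = s≤s c≤k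
    pair false false no2 c≤k = m≤n⇒m≤1+n c≤k

bit-pair-exact : ∀ a b {c k} → (a ≡ true → b ≡ true → ⊥) → c ≤ k → bit a + (bit b + c) ≡ suc k →
  (a ≡ true × b ≡ false ⊎ a ≡ false × b ≡ true) × c ≡ k
bit-pair-exact true  true  no2 c≤k eq = ⊥-elim (no2 refl refl)
bit-pair-exact true  false no2 c≤k refl = inj₁ (refl , refl) , refl
bit-pair-exact false true  no2 c≤k refl = inj₂ (refl , refl) , refl
bit-pair-exact false false no2 c≤k refl = ⊥-elim (<-irrefl refl c≤k)

exact-count⇒alternating : ∀ k f → NoTwoConsecutive f → f (suc (k * 2)) ≡ false →
  countTrue (suc k * 2) f ≡ suc k → f 0 ≡ true × Alternating (suc k * 2) f
exact-count⇒alternating zero f no2 f1≡false count with bit-pair-exact (f 0) (f 1) (no2 0) z≤n count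
... | inj₁ (f0≡true , _) , _ = f0≡true , λ where
  zero    _               → trans f1≡false (cong not (sym f0≡true))
  (suc s) (s≤s (s≤s ()))
... | inj₂ (_ , f1≡true) , _ = contradiction (trans (sym f1≡true) f1≡false) λ ()
exact-count⇒alternating (suc k) f no2 last count
  with first-pair , rest ← bit-pair-exact (f 0) (f 1) (no2 0)
                             (countTrue≤half (suc k) (f ∘ suc ∘ suc) (no2 ∘ suc ∘ suc)) count
  with f2≡true , tail-alternates ← exact-count⇒alternating k (f ∘ suc ∘ suc) (no2 ∘ suc ∘ suc) last rest
     | first-pair
... | inj₂ (_ , f1≡true)       = ⊥-elim (no2 1 f1≡true f2≡true)
... | inj₁ (f0≡true , f1≡false) = f0≡true , λ where
  zero          _                 → trans f1≡false (cong not (sym f0≡true))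
  (suc zero)    _                 → trans f2≡true (cong not (sym f1≡false))
  (suc (suc s)) (s≤s (s≤s 3+s<L)) → tail-alternates s 3+s<L

k+k≡k*2 : ∀ k → k + k ≡ k * 2
k+k≡k*2 k = trans (cong (k +_) (sym (+-identityʳ k))) (*-comm 2 k)

-- The lemmas above count over k * 2 because suc k * 2 unfolds to suc (suc (k * 2)); k + k does not.
alternation-forced : ∀ k f → NoTwoConsecutive f → f 0 ≡ false → f (k + k) ≡ false →
  countTrue (suc (k + k)) f ≡ k → Alternating (suc (k + k)) f
alternation-forced k f no2 f0≡false =
  subst (λ m → f m ≡ false → countTrue (suc m) f ≡ k → Alternating (suc m) f) (sym (k+k≡k*2 k)) (forced k)
  where
    forced : ∀ k → f (k * 2) ≡ false → countTrue (suc (k * 2)) f ≡ k → Alternating (suc (k * 2)) f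
    forced zero    _    _     s       (s≤s ())
    forced (suc k) last count
      with f1≡true , alt ← exact-count⇒alternating k (f ∘ suc) (no2 ∘ suc) last
                             (trans (cong (λ b → bit b + countTrue (suc k * 2) (f ∘ suc)) (sym f0≡false)) count)
      = λ { zero    _     → trans f1≡true (cong not (sym f0≡false))
          ; (suc s) 2+s<L → alt s (≤-pred 2+s<L) }

module CyclicIndex (l : ℕ) where

  L : ℕ
  L = suc l

  toℕ-mod : ∀ a → toℕ (a mod L) ≡ a % L
  toℕ-mod a = Fin.toℕ-fromℕ< (m%n<n a L)

  mod-cong : ∀ {a b} → a % L ≡ b % L → a mod L ≡ b mod L
  mod-cong {a} {b} eq = Fin.toℕ-injective (trans (toℕ-mod a) (trans eq (sym (toℕ-mod b))))

  toℕ-mod-id : ∀ (i : Fin L) → toℕ i mod L ≡ i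
  toℕ-mod-id i = Fin.toℕ-injective (trans (toℕ-mod (toℕ i)) (m<n⇒m%n≡m (Fin.toℕ<n i)))

  mod-periodic : ∀ a → (a + L) mod L ≡ a mod L
  mod-periodic a = mod-cong {a + L} {a} ([m+n]%n≡m%n a L)

  next-mod : ∀ a → next (a mod L) ≡ suc a mod L
  next-mod a = mod-cong {suc (toℕ (a mod L))} {suc a} (begin
    suc (toℕ (a mod L)) % L     ≡⟨ cong (λ r → suc r % L) (toℕ-mod a) ⟩
    (1 + a % L) % L             ≡⟨ %-distribˡ-+ 1 (a % L) L ⟩
    (1 % L + a % L % L) % L     ≡⟨ cong (λ r → (1 % L + r) % L) (m%n%n≡m%n a L) ⟩
    (1 % L + a % L) % L         ≡⟨ sym (%-distribˡ-+ 1 a L) ⟩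
    suc a % L                   ∎)
    where open ≡-Reasoning

  mod-onto : ∀ (i j : Fin L) → ∃ λ s → s ≤ L × (toℕ i + s) mod L ≡ j
  mod-onto i j =
    s , m%n≤n (toℕ j + (L ∸ toℕ i)) L , trans (mod-cong {toℕ i + s} {toℕ j} i+s≡j) (toℕ-mod-id j)
    where
      s : ℕ
      s = (toℕ j + (L ∸ toℕ i)) % L
      open ≡-Reasoning
      i+s≡j : (toℕ i + s) % L ≡ toℕ j % L
      i+s≡j = begin
        (toℕ i + s) % L                            ≡⟨ %-distribˡ-+ (toℕ i) s L ⟩
        (toℕ i % L + s % L) % L
          ≡⟨ cong (λ r → (toℕ i % L + r) % L) (m%n%n≡m%n (toℕ j + (L ∸ toℕ i)) L) ⟩
        (toℕ i % L + s) % L                        ≡⟨ sym (%-distribˡ-+ (toℕ i) _ L) ⟩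
        (toℕ i + (toℕ j + (L ∸ toℕ i))) % L        ≡⟨ cong (_% L) (+-comm (toℕ i) _) ⟩
        (toℕ j + (L ∸ toℕ i) + toℕ i) % L          ≡⟨ cong (_% L) (+-assoc (toℕ j) _ _) ⟩
        (toℕ j + (L ∸ toℕ i + toℕ i)) % L
          ≡⟨ cong (λ r → (toℕ j + r) % L) (m∸n+n≡m (<⇒≤ (Fin.toℕ<n i))) ⟩
        (toℕ j + L) % L                            ≡⟨ [m+n]%n≡m%n (toℕ j) L ⟩
        toℕ j % L                                  ∎

  -- a ≡ a + 2 (mod L) would make L divide 2.
  %-shift2≢ : 3 ≤ L → ∀ a → a % L ≢ suc (suc a) % L
  %-shift2≢ 3≤L a eq = ≤⇒≯ (∣⇒≤ L∣2) 3≤L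
    where
      open ≡-Reasoning
      q₁L+2≡q₂L : (a / L) * L + 2 ≡ (suc (suc a) / L) * L
      q₁L+2≡q₂L = +-cancelˡ-≡ (a % L) _ _ (begin
        a % L + ((a / L) * L + 2)                ≡⟨ sym (+-assoc (a % L) _ 2) ⟩
        a % L + (a / L) * L + 2                  ≡⟨ cong (_+ 2) (sym (m≡m%n+[m/n]*n a L)) ⟩
        a + 2                                    ≡⟨ +-comm a 2 ⟩
        suc (suc a)                              ≡⟨ m≡m%n+[m/n]*n (suc (suc a)) L ⟩
        suc (suc a) % L + (suc (suc a) / L) * L  ≡⟨ cong (_+ (suc (suc a) / L) * L) (sym eq) ⟩
        a % L + (suc (suc a) / L) * L            ∎)
      L∣2 : L ∣ 2
      L∣2 = ∣m+n∣m⇒∣n (subst (L ∣_) (sym q₁L+2≡q₂L) (n∣m*n (suc (suc a) / L))) (n∣m*n (a / L))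

module _ {n : ℕ} {G : Graph n} {M : EdgeSet n} where

  ∷-isAltWalk : ∀ {a y z} mid → Adj G a y → ExactlyOne (M a y) (FirstInM M (walkList y mid z)) →
    IsAltWalk G M (walkList y mid z) → IsAltWalk G M (a ∷ walkList y mid z)
  ∷-isAltWalk []      ay alt (walk , alts) = (ay , walk) , alt , alts
  ∷-isAltWalk (_ ∷ _) ay alt (walk , alts) = (ay , walk) , alt , alts

  isAltWalk-∷⁻ : ∀ {a y z} mid → IsAltWalk G M (a ∷ walkList y mid z) →
    Adj G a y × ExactlyOne (M a y) (FirstInM M (walkList y mid z)) × IsAltWalk G M (walkList y mid z)
  isAltWalk-∷⁻ []      ((ay , walk) , alt , alts) = ay , alt , walk , alts
  isAltWalk-∷⁻ (_ ∷ _) ((ay , walk) , alt , alts) = ay , alt , walk , alts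

interior : ∀ {A : Set} → (ℕ → A) → ℕ → List A
interior g zero    = []
interior g (suc m) = g 1 ∷ interior (g ∘ suc) m

tour : ∀ {n} → (ℕ → Fin n) → ℕ → List (Fin n)
tour g m = walkList (g 0) (interior g m) (g (suc m))

∈-tour : ∀ {n} m (g : ℕ → Fin n) s → s ≤ suc m → g s ∈ₗ tour g m
∈-tour m       g zero          _          = here refl
∈-tour zero    g (suc zero)    _          = there (here refl)
∈-tour zero    g (suc (suc s)) (s≤s ())
∈-tour (suc m) g (suc s)       (s≤s s≤m) = there (∈-tour m (g ∘ suc) s s≤m)

module _ {n : ℕ} {M : EdgeSet n} where

  LastInM-∷ : ∀ {a y z} mid → LastInM M (a ∷ walkList y mid z) ≡ LastInM M (walkList y mid z)
  LastInM-∷ []      = refl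
  LastInM-∷ (_ ∷ _) = refl

  FirstInM-tour : ∀ m (g : ℕ → Fin n) → FirstInM M (tour g m) ≡ M (g 0) (g 1)
  FirstInM-tour zero    g = refl
  FirstInM-tour (suc m) g = refl

  LastInM-tour : ∀ m (g : ℕ → Fin n) → LastInM M (tour g m) ≡ M (g m) (g (suc m))
  LastInM-tour zero    g = refl
  LastInM-tour (suc m) g = trans (LastInM-∷ {a = g 0} (interior (g ∘ suc) m)) (LastInM-tour m (g ∘ suc))

module _ {n : ℕ} {G : Graph n} {M : EdgeSet n} where

  tour-isAltWalk : ∀ m (g : ℕ → Fin n) → (∀ s → Adj G (g s) (g (suc s))) →
    (∀ s → s < m → ExactlyOne (M (g s) (g (suc s))) (M (g (suc s)) (g (suc (suc s))))) →
    IsAltWalk G M (tour g m)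
  tour-isAltWalk zero    g adj alt = (adj 0 , tt) , tt
  tour-isAltWalk (suc m) g adj alt =
    ∷-isAltWalk (interior (g ∘ suc) m) (adj 0)
      (subst (ExactlyOne (M (g 0) (g 1))) (sym (FirstInM-tour m (g ∘ suc))) (alt 0 (s≤s z≤n)))
      (tour-isAltWalk m (g ∘ suc) (adj ∘ suc) λ s s<m → alt (suc s) (s≤s s<m))

ExactlyOne-sym : ∀ {P Q : Set} → ExactlyOne P Q → ExactlyOne Q P
ExactlyOne-sym (inj₁ (p , ¬q)) = inj₂ (¬q , p)
ExactlyOne-sym (inj₂ (¬p , q)) = inj₁ (q , ¬p)

crossing-edge : ∀ {n} {G : Graph n} {P : Fin n → Set} → (∀ x → Dec (P x)) →
  ∀ {a t} → Reachable G a t → P a → ¬ P t → ∃₂ λ p q → P p × ¬ P q × Adj G p q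
crossing-edge P? here                  Pa ¬Pt = contradiction Pa ¬Pt
crossing-edge P? (step {w = w} a~w w~t) Pa ¬Pt with P? w
... | yes Pw  = crossing-edge P? w~t Pw ¬Pt
... | no  ¬Pw = _ , w , Pa , ¬Pw , a~w

module PerfectMatching {n : ℕ} {G : Graph n} {M : EdgeSet n} (pm : IsPerfectMatching G M) where
  open IsPerfectMatching pm
  open IsMatching matching

  mate : Fin n → Fin n
  mate u = proj₁ (cover u)

  M-mate : ∀ u → M u (mate u)
  M-mate u = proj₂ (cover u)

  M⇒≡mate : ∀ {u v} → M u v → v ≡ mate u
  M⇒≡mate {u} m = uniq m (M-mate u)

  mate-involutive : ∀ u → mate (mate u) ≡ u
  mate-involutive u = sym (M⇒≡mate (msym (M-mate u)))

  mate-injective : ∀ {u v} → mate u ≡ mate v → u ≡ v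
  mate-injective {u} {v} eq = begin
    u               ≡⟨ sym (mate-involutive u) ⟩
    mate (mate u)   ≡⟨ cong mate eq ⟩
    mate (mate v)   ≡⟨ mate-involutive v ⟩
    v               ∎
    where open ≡-Reasoning

  Adj-mate : ∀ u → Adj G u (mate u)
  Adj-mate u = sub (M-mate u)

  M? : ∀ u v → Dec (M u v)
  M? u v with v ≟ mate u
  ... | yes refl = yes (M-mate u)
  ... | no  v≢   = no (v≢ ∘ M⇒≡mate)

  -- p ⇝ q: the M-edge from p to its mate, followed by a non-M edge to q.
  _⇝_ : Fin n → Fin n → Set
  p ⇝ q = Adj G q (mate p) × q ≢ p

  _⇝?_ : ∀ p q → Dec (p ⇝ q)
  p ⇝? q = dec G q (mate p) ×-dec ¬? (q ≟ p)

  ⇝-∷ : ∀ {a b v} mid → a ⇝ b → IsMMAltWalk G M (walkList b mid v) →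
    IsMMAltWalk G M (walkList a (mate a ∷ b ∷ mid) v)
  ⇝-∷ {a} {b} {v} mid (b~mate-a , b≢a) (walk , first , last) =
    ∷-isAltWalk (b ∷ mid) (Adj-mate a) (inj₁ (M-mate a , ¬M-mate-a-b))
      (∷-isAltWalk mid (Graph.sym G b~mate-a) (inj₂ (¬M-mate-a-b , first)) walk) ,
    M-mate a ,
    subst id (sym (trans (LastInM-∷ {a = a} (b ∷ mid)) (LastInM-∷ {a = mate a} mid))) last
    where
      ¬M-mate-a-b : ¬ M (mate a) b
      ¬M-mate-a-b m = b≢a (trans (M⇒≡mate m) (mate-involutive a))

  ⇝*-mate⇒InR : ∀ {a v} → Star _⇝_ a (mate v) → InR G M v a
  ⇝*-mate⇒InR {v = v} ε = [] , ((sub M-v , tt) , tt) , M-v , M-v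
    where
      M-v : M (mate v) v
      M-v = msym (M-mate v)
  ⇝*-mate⇒InR {a} (_◅_ {j = b} a⇝b b⇝*) with mid , walk ← ⇝*-mate⇒InR b⇝* =
    mate a ∷ b ∷ mid , ⇝-∷ mid a⇝b walk

3≤1+k+k : ∀ k → k + k ≢ 0 → 3 ≤ suc (k + k)
3≤1+k+k zero    k+k≢0 = contradiction refl k+k≢0
3≤1+k+k (suc k) _ rewrite +-suc k k = s≤s (s≤s (s≤s z≤n))

module BlossomTour {n : ℕ} {G : Graph n} {M : EdgeSet n} (matching : IsMatching G M)
  (B : Blossom G M) (i : Fin (suc (k B + k B))) where
  open IsMatching matching
  open CyclicIndex (k B + k B)

  position : ℕ → Fin L
  position s = (toℕ i + s) mod L

  vertex : ℕ → Fin n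
  vertex s = c B (position s)

  inM : ℕ → Bool
  inM s = lookup (Medges B) (position s)

  position-0 : position 0 ≡ i
  position-0 = trans (cong (_mod L) (+-identityʳ (toℕ i))) (toℕ-mod-id i)

  position-L : position L ≡ i
  position-L = trans (mod-periodic (toℕ i)) (toℕ-mod-id i)

  next-position : ∀ s → next (position s) ≡ position (suc s)
  next-position s = trans (next-mod (toℕ i + s)) (cong (_mod L) (sym (+-suc (toℕ i) s)))

  vertex-adj : ∀ s → Adj G (vertex s) (vertex (suc s))
  vertex-adj s = subst (λ j → Adj G (vertex s) (c B j)) (next-position s) (adj B (position s))

  inM⇒M : ∀ s → inM s ≡ true → M (vertex s) (vertex (suc s))
  inM⇒M s t = subst (λ j → M (vertex s) (c B j)) (next-position s)
                (Equivalence.to (isM B (position s)) (lookup⇒[]= (position s) (Medges B) t))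

  M⇒inM : ∀ s → M (vertex s) (vertex (suc s)) → inM s ≡ true
  M⇒inM s m = []=⇒lookup (Equivalence.from (isM B (position s))
                (subst (λ j → M (vertex s) (c B j)) (sym (next-position s)) m))

  ¬M⇒¬inM : ∀ s → ¬ M (vertex s) (vertex (suc s)) → inM s ≡ false
  ¬M⇒¬inM s ¬m with inM s in eq
  ... | true  = contradiction (inM⇒M s eq) ¬m
  ... | false = refl

  countTrue-inM : countTrue L inM ≡ k B
  countTrue-inM = begin
    countTrue L (λ s → lookup (Medges B) ((toℕ i + s) mod L))
      ≡⟨ countTrue-rotate L (λ s → lookup (Medges B) (s mod L))
           (cong (lookup (Medges B)) ∘ mod-periodic) (toℕ i) ⟩
    countTrue L (λ s → lookup (Medges B) (s mod L))
      ≡⟨ countTrue-cong L (λ s s<L → sym (lookupℕ-mod s s<L)) ⟩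
    countTrue L (lookupℕ (Medges B))
      ≡⟨ sym (∣p∣≡countTrue (Medges B)) ⟩
    ∣ Medges B ∣
      ≡⟨ count B ⟩
    k B ∎
    where
      open ≡-Reasoning
      lookupℕ-mod : ∀ s → s < L → lookupℕ (Medges B) s ≡ lookup (Medges B) (s mod L)
      lookupℕ-mod s s<L = trans (cong (lookupℕ (Medges B)) (sym (trans (toℕ-mod s) (m<n⇒m%n≡m s<L))))
                                (lookupℕ-toℕ (Medges B) (s mod L))

  -- A one-vertex cycle would be a loop.
  3≤L : 3 ≤ L
  3≤L = 3≤1+k+k (k B) λ k+k≡0 → irrefl G (subst (λ j → Adj G (c B i) (c B j)) (Fin1-all-equal k+k≡0) (adj B i))
    where
      Fin1-all-equal : k B + k B ≡ 0 → next i ≡ i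
      Fin1-all-equal k+k≡0 = Fin.toℕ-injective (trans (toℕ≡0 (next i)) (sym (toℕ≡0 i)))
        where
          toℕ≡0 : ∀ (j : Fin L) → toℕ j ≡ 0
          toℕ≡0 j = n<1⇒n≡0 (subst (toℕ j <_) (cong suc k+k≡0) (Fin.toℕ<n j))

  -- Two consecutive M-edges share their middle vertex, so vertex s ≡ vertex (s + 2).
  inM-noTwoConsecutive : NoTwoConsecutive inM
  inM-noTwoConsecutive s t₁ t₂ = %-shift2≢ 3≤L (toℕ i + s) (begin
    (toℕ i + s) % L                 ≡⟨ sym (toℕ-mod (toℕ i + s)) ⟩
    toℕ (position s)                ≡⟨ cong toℕ (inj B _ _ (uniq (msym (inM⇒M s t₁)) (inM⇒M (suc s) t₂))) ⟩
    toℕ (position (suc (suc s)))    ≡⟨ toℕ-mod (toℕ i + suc (suc s)) ⟩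
    (toℕ i + suc (suc s)) % L       ≡⟨ cong (_% L) (trans (+-suc (toℕ i) (suc s)) (cong suc (+-suc (toℕ i) s))) ⟩
    suc (suc (toℕ i + s)) % L       ∎)
    where open ≡-Reasoning

  alternating⇒exactlyOne : Alternating L inM → ∀ s → suc s < L →
    ExactlyOne (M (vertex s) (vertex (suc s))) (M (vertex (suc s)) (vertex (suc (suc s))))
  alternating⇒exactlyOne alt s 1+s<L with inM s in eq
  ... | true  = inj₁ (inM⇒M s eq , λ m → contradiction (trans (sym (M⇒inM (suc s) m)) next-inM) λ ())
    where
      next-inM : inM (suc s) ≡ false
      next-inM = trans (alt s 1+s<L) (cong not eq)
  ... | false = inj₂ ((λ m → contradiction (trans (sym (M⇒inM s m)) eq) λ ()) , inM⇒M (suc s) next-inM)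
    where
      next-inM : inM (suc s) ≡ true
      next-inM = trans (alt s 1+s<L) (cong not eq)

  vertex-onto : ∀ {x} → OnBlossom x B → ∃ λ s → s ≤ L × vertex s ≡ x
  vertex-onto (j , cj≡x) with s , s≤L , position-s≡j ← mod-onto i j =
    s , s≤L , trans (cong (c B) position-s≡j) cj≡x

blossom-tour : ∀ {n} {G : Graph n} {M : EdgeSet n} → IsMatching G M → (B : Blossom G M) → ∀ {b} → IsBase B b →
  ∃ λ mid → IsAltWalk G M (walkList b mid b) × ¬ FirstInM M (walkList b mid b) × ¬ LastInM M (walkList b mid b) ×
            (∀ {x} → OnBlossom x B → x ∈ₗ walkList b mid b)
blossom-tour {n} {G} {M} matching B {b} ((i , ci≡b) , b-unmatched) =
  inner , subst₂ AltTour vertex-0≡b vertex-L≡b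
          (tour-isAltWalk 2k vertex vertex-adj (λ s s<2k → alternating⇒exactlyOne alternating s (s≤s s<2k)) ,
           ¬M-first ∘ subst id (FirstInM-tour 2k vertex) ,
           ¬M-last ∘ subst id (LastInM-tour 2k vertex) ,
           on-tour)
  where
    open IsMatching matching
    open BlossomTour matching B i
    2k : ℕ
    2k = k B + k B
    inner : List (Fin n)
    inner = interior vertex 2k
    AltTour : Fin n → Fin n → Set
    AltTour a z = IsAltWalk G M (walkList a inner z) × ¬ FirstInM M (walkList a inner z) ×
                  ¬ LastInM M (walkList a inner z) × (∀ {x} → OnBlossom x B → x ∈ₗ walkList a inner z)
    vertex-0≡b : vertex 0 ≡ b
    vertex-0≡b = trans (cong (c B) position-0) ci≡b
    vertex-L≡b : vertex (suc 2k) ≡ b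
    vertex-L≡b = trans (cong (c B) position-L) ci≡b
    ¬M-first : ¬ M (vertex 0) (vertex 1)
    ¬M-first m = b-unmatched (position 1) (subst (λ a → M a (vertex 1)) vertex-0≡b m)
    ¬M-last : ¬ M (vertex 2k) (vertex (suc 2k))
    ¬M-last m = b-unmatched (position 2k) (msym (subst (M (vertex 2k)) vertex-L≡b m))
    alternating : Alternating (suc 2k) inM
    alternating = alternation-forced (k B) inM inM-noTwoConsecutive
                    (¬M⇒¬inM 0 ¬M-first) (¬M⇒¬inM 2k ¬M-last) countTrue-inM
    on-tour : ∀ {x} → OnBlossom x B → x ∈ₗ tour vertex 2k
    on-tour x∈B with s , s≤L , vertex-s≡x ← vertex-onto x∈B =
      subst (_∈ₗ tour vertex 2k) vertex-s≡x (∈-tour 2k vertex s s≤L)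

module Barrier {n : ℕ} {G : Graph n} {M : EdgeSet n} (pm : IsPerfectMatching G M) (S : Subset n)
  (S-closed : ∀ {p q} → p ∈ S → PerfectMatching._⇝_ pm p q → q ∈ S) where
  open PerfectMatching pm

  X Y : Fin n → Set
  X x = x ∉ S × mate x ∈ S
  Y y = y ∈ S × mate y ∉ S

  mate∈S⇒neighbours∈S : ∀ {p q} → mate p ∈ S → Adj G q p → q ∈ S
  mate∈S⇒neighbours∈S {p} {q} mate-p∈S q~p with q ≟ mate p
  ... | yes refl = mate-p∈S
  ... | no  q≢   = S-closed mate-p∈S (subst (Adj G q) (sym (mate-involutive p)) q~p , q≢)

  X→Y : ∀ {x z} → X x → Adj G x z → Y z
  X→Y (x∉S , mate-x∈S) x~z =
    mate∈S⇒neighbours∈S mate-x∈S (Graph.sym G x~z) ,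
    λ mate-z∈S → x∉S (mate∈S⇒neighbours∈S mate-z∈S x~z)

  Y→X-mate : ∀ {y} → Y y → X (mate y)
  Y→X-mate {y} (y∈S , mate-y∉S) = mate-y∉S , subst (_∈ S) (sym (mate-involutive y)) y∈S

  X∩Y=∅ : ∀ {x} → X x → Y x → ⊥
  X∩Y=∅ (x∉S , _) (x∈S , _) = x∉S x∈S

  -- mate′ ∘ mate maps Y injectively into itself, hence onto Y.
  Y→X : ∀ {M′} → IsPerfectMatching G M′ → ∀ {y z} → Y y → M′ y z → X z
  Y→X {M′} pm′ {y} {z} y∈Y yz = subst X (sym z≡mate-w) (Y→X-mate w∈Y)
    where
      open PerfectMatching pm′ using ()
        renaming (mate to mate′; mate-injective to mate′-injective; Adj-mate to Adj-mate′;
                  M⇒≡mate to M′⇒≡mate′; mate-involutive to mate′-involutive)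
      preimage : ∃ λ w → Y w × mate′ (mate w) ≡ y
      preimage = injective⇒preimage (mate′ ∘ mate) (mate-injective ∘ mate′-injective) Y
                   (λ {w} w∈Y → X→Y (Y→X-mate w∈Y) (Adj-mate′ (mate w))) y∈Y
      w : Fin n
      w = proj₁ preimage
      w∈Y : Y w
      w∈Y = proj₁ (proj₂ preimage)
      z≡mate-w : z ≡ mate w
      z≡mate-w = begin
        z                      ≡⟨ M′⇒≡mate′ yz ⟩
        mate′ y                ≡⟨ cong mate′ (sym (proj₂ (proj₂ preimage))) ⟩
        mate′ (mate′ (mate w)) ≡⟨ mate′-involutive (mate w) ⟩
        mate w                 ∎
        where open ≡-Reasoning

  X-inhabited : Connected G → ∀ {u t} → u ∈ S → t ∉ S → ∃ X
  X-inhabited connected u∈S t∉S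
    with p , q , p∈S , q∉S , p~q ← crossing-edge (_∈? S) (connected _ _) u∈S t∉S
    = mate p , (λ mate-p∈S → q∉S (mate∈S⇒neighbours∈S mate-p∈S (Graph.sym G p~q))) ,
      subst (_∈ S) (sym (mate-involutive p)) p∈S

module Trap {n : ℕ} {G : Graph n} {M : EdgeSet n} (pm : IsPerfectMatching G M)
  (X Y : Fin n → Set)
  (X→Y : ∀ {x z} → X x → Adj G x z → Y z)
  (Y→X : ∀ {y z} → Y y → M y z → X z)
  (X∩Y=∅ : ∀ {x} → X x → Y x → ⊥) where
  open IsPerfectMatching pm
  open IsMatching matching
  open PerfectMatching pm using (M?)

  -- Read e as "the edge at x lies in M".  Leaving x Trapped, an alternating walk stays in X ∪ Y,
  -- crossing from X to Y by non-M edges and from Y to X by M edges; it then arrives Caught.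
  Caught Trapped : Fin n → Set → Set
  Caught  x e = (X x × e) ⊎ (Y x × ¬ e)
  Trapped x e = (X x × ¬ e) ⊎ (Y x × e)

  Caught⇒X : ∀ {x e} → Caught x e → e → X x
  Caught⇒X (inj₁ (x∈X , _)) _ = x∈X
  Caught⇒X (inj₂ (_ , ¬e))  e = contradiction e ¬e

  Caught⇒Y : ∀ {x e} → Caught x e → ¬ e → Y x
  Caught⇒Y (inj₁ (_ , e))   ¬e = contradiction e ¬e
  Caught⇒Y (inj₂ (x∈Y , _)) _  = x∈Y

  trapped⇒caught : ∀ {a b} → Adj G a b → Trapped a (M a b) → Caught b (M a b)
  trapped⇒caught ab (inj₁ (a∈X , ¬m)) = inj₂ (X→Y a∈X ab , ¬m)
  trapped⇒caught ab (inj₂ (a∈Y , m))  = inj₁ (Y→X a∈Y m , m)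

  trapped⇒caughtʳ : ∀ {a b} → Adj G a b → Trapped b (M a b) → Caught a (M a b)
  trapped⇒caughtʳ ab (inj₁ (b∈X , ¬m)) = inj₂ (X→Y b∈X (Graph.sym G ab) , ¬m)
  trapped⇒caughtʳ ab (inj₂ (b∈Y , m))  = inj₁ (Y→X b∈Y (msym m) , m)

  caught⇒trapped : ∀ {x e₁ e₂} → ExactlyOne e₁ e₂ → Caught x e₁ → Trapped x e₂
  caught⇒trapped (inj₁ (_ , ¬e₂)) (inj₁ (x∈X , _))  = inj₁ (x∈X , ¬e₂)
  caught⇒trapped (inj₂ (¬e₁ , _)) (inj₁ (_ , e₁))   = contradiction e₁ ¬e₁
  caught⇒trapped (inj₁ (e₁ , _))  (inj₂ (_ , ¬e₁))  = contradiction e₁ ¬e₁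
  caught⇒trapped (inj₂ (_ , e₂))  (inj₂ (x∈Y , _))  = inj₂ (x∈Y , e₂)

  trapped-start⇒caught-end : ∀ {a z} mid → IsAltWalk G M (walkList a mid z) →
    Trapped a (FirstInM M (walkList a mid z)) → Caught z (LastInM M (walkList a mid z))
  trapped-start⇒caught-end []            ((az , _) , _) trapped = trapped⇒caught az trapped
  trapped-start⇒caught-end {a} (y ∷ mid) walk trapped
    with ay , alt , walk′ ← isAltWalk-∷⁻ mid walk
    = subst (Caught _) (sym (LastInM-∷ {a = a} mid))
        (trapped-start⇒caught-end mid walk′ (caught⇒trapped alt (trapped⇒caught ay trapped)))

  trapped-end⇒caught-start : ∀ {a z} mid → IsAltWalk G M (walkList a mid z) →
    Trapped z (LastInM M (walkList a mid z)) → Caught a (FirstInM M (walkList a mid z))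
  trapped-end⇒caught-start []            ((az , _) , _) trapped = trapped⇒caughtʳ az trapped
  trapped-end⇒caught-start {a} (y ∷ mid) walk trapped
    with ay , alt , walk′ ← isAltWalk-∷⁻ mid walk
    = trapped⇒caughtʳ ay (caught⇒trapped (ExactlyOne-sym alt)
        (trapped-end⇒caught-start mid walk′ (subst (Trapped _) (LastInM-∷ {a = a} mid) trapped)))

  FirstInM? : ∀ {a z} mid → Dec (FirstInM M (walkList a mid z))
  FirstInM? {a} {z} []      = M? a z
  FirstInM? {a}     (y ∷ _) = M? a y

  X-vertex⇒caught-at-an-end : ∀ {a z x} mid → IsAltWalk G M (walkList a mid z) → x ∈ₗ walkList a mid z → X x →
    Caught a (FirstInM M (walkList a mid z)) ⊎ Caught z (LastInM M (walkList a mid z))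
  X-vertex⇒caught-at-an-end mid walk (here refl) x∈X with FirstInM? mid
  ... | yes m = inj₁ (inj₁ (x∈X , m))
  ... | no ¬m = inj₂ (trapped-start⇒caught-end mid walk (inj₁ (x∈X , ¬m)))
  X-vertex⇒caught-at-an-end {a} {z} [] walk (there (here refl)) x∈X with M? a z
  ... | yes m = inj₂ (inj₁ (x∈X , m))
  ... | no ¬m = inj₁ (trapped-end⇒caught-start [] walk (inj₁ (x∈X , ¬m)))
  X-vertex⇒caught-at-an-end {a} (y ∷ mid) walk (there x∈) x∈X
    with ay , alt , walk′ ← isAltWalk-∷⁻ mid walk | X-vertex⇒caught-at-an-end mid walk′ x∈ x∈X
  ... | inj₁ caught = inj₁ (trapped⇒caughtʳ ay (caught⇒trapped (ExactlyOne-sym alt) caught))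
  ... | inj₂ caught = inj₂ (subst (Caught _) (sym (LastInM-∷ {a = a} mid)) caught)

  mmWalk-end-in-X : ∀ {a z x} mid → IsMMAltWalk G M (walkList a mid z) → x ∈ₗ walkList a mid z → X x →
    X a ⊎ X z
  mmWalk-end-in-X mid (walk , first , last) x∈ x∈X with X-vertex⇒caught-at-an-end mid walk x∈ x∈X
  ... | inj₁ caught = inj₁ (Caught⇒X caught first)
  ... | inj₂ caught = inj₂ (Caught⇒X caught last)

  blossom-base-in-Y : ∀ (B : Blossom G M) {b x} → IsBase B b → OnBlossom x B → X x → Y b
  blossom-base-in-Y B base x∈B x∈X
    with inner , walk , ¬first , ¬last , on-tour ← blossom-tour matching B base
    with X-vertex⇒caught-at-an-end inner walk (on-tour x∈B) x∈X
  ... | inj₁ caught = Caught⇒Y caught ¬first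
  ... | inj₂ caught = Caught⇒Y caught ¬last

  base-not-in-X : ∀ (B : Blossom G M) {b} → IsBase B b → ¬ X b
  base-not-in-X B base b∈X = X∩Y=∅ b∈X (blossom-base-in-Y B base (proj₁ base) b∈X)

  jposy-avoids-X : ∀ (J : Jposy G M) {x} → OnJposy x J → ¬ X x
  jposy-avoids-X J on-J x∈X with Jposy.walk J | on-J
  ... | alt-walk , first , last | inj₁ x∈B₁ =
    base-not-in-X (B₂ J) (base₂ J)
      (Caught⇒X (trapped-start⇒caught-end (mid J) alt-walk (inj₂ (b₁∈Y , first))) last)
    where
      b₁∈Y : Y (b₁ J)
      b₁∈Y = blossom-base-in-Y (B₁ J) (base₁ J) x∈B₁ x∈X
  ... | alt-walk , first , last | inj₂ (inj₁ x∈B₂) =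
    base-not-in-X (B₁ J) (base₁ J)
      (Caught⇒X (trapped-end⇒caught-start (mid J) alt-walk (inj₂ (b₂∈Y , last))) first)
    where
      b₂∈Y : Y (b₂ J)
      b₂∈Y = blossom-base-in-Y (B₂ J) (base₂ J) x∈B₂ x∈X
  ... | mm-walk | inj₂ (inj₂ x∈walk) with mmWalk-end-in-X (mid J) mm-walk x∈walk x∈X
  ...   | inj₁ b₁∈X = base-not-in-X (B₁ J) (base₁ J) b₁∈X
  ...   | inj₂ b₂∈X = base-not-in-X (B₂ J) (base₂ J) b₂∈X

mainTheorem5 : (n : ℕ) (G : Graph n) → Connected G →
    Σ (EdgeSet n) (λ M₀ → IsPerfectMatching G M₀) →
    (M : EdgeSet n) → IsPerfectMatching G M →
    KEPartEmpty G →
    ∀ (v u : Fin n) → InR G M v u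
mainTheorem5 n G connected _ M pm every-vertex-in-SD v u = case mate v ∈? reachable of λ where
    (yes mate-v∈S) → ⇝*-mate⇒InR (reachable⇒⇝* mate-v∈S)
    (no  mate-v∉S) → ⊥-elim (X-empty (X-inhabited connected u∈reachable mate-v∉S))
  where
    open PerfectMatching pm
    open Reachability _⇝?_ u
    open Barrier pm reachable reachable-closed
    X-empty : ∃ X → ⊥
    X-empty (x , x∈X) with M′ , pm′ , J , x∈J ← every-vertex-in-SD x =
      Trap.jposy-avoids-X pm′ X Y X→Y (Y→X pm′) X∩Y=∅ J x∈J x∈X
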